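{- Let $\mathbf A$ be an FL${}_{\mathrm e}$-algebra and let $x{\Rightarrow} y:=(x\to y)\wedge(y\to\neg\neg x)$. Then $\mathbf A$ satisfies $1\leq (x{\Rightarrow} y){\Rightarrow}\neg(x{\Rightarrow}\neg y)$ for all $x,y\in A$ if and only if it satisfies $1\leq (x{\Rightarrow} y){\Rightarrow}[(y{\Rightarrow} z){\Rightarrow}\neg(x{\Rightarrow}\neg z)]$ for all $x,y,z\in A$.
   Context: An FL${}_{\mathrm e}$-algebra is an algebra $\langle A,\wedge,\vee,\cdot,\to,0,1\rangle$ such that $\langle A,\wedge,\vee\rangle$ is a lattice (with order $\leq$), $\langle A,\cdot,1\rangle$ is a commutative monoid, $0$ is an arbitrary constant, and $x\cdot y\leq z\iff x\leq y\to z$. Write $\neg x:=x\to 0$. -}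

module Defs where

open import Level using (Level; suc)
open import Relation.Binary.PropositionalEquality using (_≡_)
open import Data.Product using (_×_)
open import Function.Bundles using (_⇔_)

record FLe (a : Level) : Set (suc a) where
  infixr 5 _⇒_
  infixl 7 _·_
  infixr 6 _∧_
  infixr 5 _∨_
  infix 4 _≤_
  infixr 5 _⇛_
  infix 8 ¬_
  field
    Carrier : Set a
    _∧_ _∨_ _·_ _⇒_ : Carrier → Carrier → Carrier
    𝟘 𝟙 : Carrier
    ∧-comm   : ∀ x y → x ∧ y ≡ y ∧ x
    ∨-comm   : ∀ x y → x ∨ y ≡ y ∨ x
    ∧-assoc  : ∀ x y z → (x ∧ y) ∧ z ≡ x ∧ (y ∧ z)
    ∨-assoc  : ∀ x y z → (x ∨ y) ∨ z ≡ x ∨ (y ∨ z)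
    ∧-absorb : ∀ x y → x ∧ (x ∨ y) ≡ x
    ∨-absorb : ∀ x y → x ∨ (x ∧ y) ≡ x
    ·-comm   : ∀ x y → x · y ≡ y · x
    ·-assoc  : ∀ x y z → (x · y) · z ≡ x · (y · z)
    ·-identityˡ : ∀ x → 𝟙 · x ≡ x

  _≤_ : Carrier → Carrier → Set a
  x ≤ y = x ∧ y ≡ x

  field
    residuation : ∀ x y z → (x · y ≤ z) ⇔ (x ≤ y ⇒ z)

  ¬_ : Carrier → Carrier
  ¬ x = x ⇒ 𝟘

  _⇛_ : Carrier → Carrier → Carrier
  x ⇛ y = (x ⇒ y) ∧ (y ⇒ ¬ (¬ x))

{-# OPTIONS --safe #-}
-- Since 1 ≤ a ⇛ b holds iff a ≤ b ≤ ¬¬a, the binary law says that x ⇛ y and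
-- x ⇛ ¬y are orthogonal (x ⇛ y ≤ ¬(x ⇛ ¬y)) and that ¬(x ⇛ ¬y) ≤ ¬¬(x ⇛ y).
-- The ternary law yields the binary one by taking z = y, resp. y = x, because
-- 1 ≤ y ⇛ y.  Conversely, ⇛ composes up to double negation:
-- (x ⇛ y)(y ⇛ z) ≤ x ⇛ z, (x ⇛ y)(x ⇛ z) ≤ y ⇛ ¬¬z and x ⇛ y ≤ ¬x ⇛ ¬y; each
-- of the three inequalities making up the ternary law is obtained by feeding
-- these into the two halves of the binary law.
module Submission where

open import Defs
open import Level using (Level)
open import Function.Bundles using (_⇔_; mk⇔; Equivalence)
open import Relation.Binary.PropositionalEquality using (_≡_; refl; sym; trans; cong)

module FLeProperties {a : Level} (A : FLe a) where
  open FLe A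

  infixr 4 _▸_

  ≤-refl : ∀ {x} → x ≤ x
  ≤-refl {x} = trans (cong (x ∧_) (sym (∨-absorb x x))) (∧-absorb x (x ∧ x))

  _▸_ : ∀ {x y z} → x ≤ y → y ≤ z → x ≤ z
  _▸_ {x} {y} {z} p q =
    trans (cong (_∧ z) (sym p)) (trans (∧-assoc x y z) (trans (cong (x ∧_) q) p))

  ≡⇒≤ : ∀ {x y} → x ≡ y → x ≤ y
  ≡⇒≤ refl = ≤-refl

  ≤-antisym : ∀ {x y} → x ≤ y → y ≤ x → x ≡ y
  ≤-antisym {x} {y} p q = trans (sym p) (trans (∧-comm x y) q)

  ∧-lowerˡ : ∀ {x y} → x ∧ y ≤ x
  ∧-lowerˡ {x} {y} =
    trans (∧-assoc x y x)
      (trans (cong (x ∧_) (∧-comm y x)) (trans (sym (∧-assoc x x y)) (cong (_∧ y) ≤-refl)))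

  ∧-lowerʳ : ∀ {x y} → x ∧ y ≤ y
  ∧-lowerʳ {x} {y} = trans (∧-assoc x y y) (cong (x ∧_) ≤-refl)

  ∧-greatest : ∀ {z x y} → z ≤ x → z ≤ y → z ≤ x ∧ y
  ∧-greatest {z} {x} {y} p q = trans (sym (∧-assoc z x y)) (trans (cong (_∧ y) p) q)

  ·-identityʳ : ∀ x → x · 𝟙 ≡ x
  ·-identityʳ x = trans (·-comm x 𝟙) (·-identityˡ x)

  ·-swapʳ : ∀ x y z → (x · y) · z ≡ (x · z) · y
  ·-swapʳ x y z = trans (·-assoc x y z) (trans (cong (x ·_) (·-comm y z)) (sym (·-assoc x z y)))

  ⇒-intro : ∀ {x y z} → x · y ≤ z → x ≤ y ⇒ z
  ⇒-intro {x} {y} {z} = Equivalence.to (residuation x y z)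

  ⇒-elim : ∀ {x y z} → x ≤ y ⇒ z → x · y ≤ z
  ⇒-elim {x} {y} {z} = Equivalence.from (residuation x y z)

  ⇒-apply : ∀ {x y} → (x ⇒ y) · x ≤ y
  ⇒-apply = ⇒-elim ≤-refl

  ·-monoˡ : ∀ {x y c} → x ≤ y → x · c ≤ y · c
  ·-monoˡ x≤y = ⇒-elim (x≤y ▸ ⇒-intro ≤-refl)

  ·-monoʳ : ∀ {x y c} → x ≤ y → c · x ≤ c · y
  ·-monoʳ {x} {y} {c} x≤y = ≡⇒≤ (·-comm c x) ▸ ·-monoˡ x≤y ▸ ≡⇒≤ (·-comm y c)

  ·-mono : ∀ {x y u v} → x ≤ y → u ≤ v → x · u ≤ y · v
  ·-mono x≤y u≤v = ·-monoˡ x≤y ▸ ·-monoʳ u≤v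

  ⇒-compose : ∀ {x y z} → (x ⇒ y) · (y ⇒ z) ≤ x ⇒ z
  ⇒-compose {x} {y} {z} = ⇒-intro
    (≡⇒≤ (trans (cong (_· x) (·-comm (x ⇒ y) (y ⇒ z))) (·-assoc (y ⇒ z) (x ⇒ y) x))
     ▸ ·-monoʳ ⇒-apply ▸ ⇒-apply)

  ⇒-monoʳ : ∀ {x y c} → x ≤ y → c ⇒ x ≤ c ⇒ y
  ⇒-monoʳ x≤y = ⇒-intro (⇒-apply ▸ x≤y)

  𝟙≤-inflate : ∀ {c x} → 𝟙 ≤ c → x ≤ x · c
  𝟙≤-inflate {c} {x} 𝟙≤c = ≡⇒≤ (sym (·-identityʳ x)) ▸ ·-monoʳ 𝟙≤c

  𝟙≤-discharge : ∀ {c x y} → 𝟙 ≤ c → x ≤ c ⇒ y → x ≤ y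
  𝟙≤-discharge 𝟙≤c x≤c⇒y = 𝟙≤-inflate 𝟙≤c ▸ ⇒-elim x≤c⇒y

  ⇒-internalise : ∀ {x y} → x ≤ y → 𝟙 ≤ x ⇒ y
  ⇒-internalise {x} x≤y = ⇒-intro (≡⇒≤ (·-identityˡ x) ▸ x≤y)

  ⇒-externalise : ∀ {x y} → 𝟙 ≤ x ⇒ y → x ≤ y
  ⇒-externalise {x} 𝟙≤x⇒y = ≡⇒≤ (sym (·-identityˡ x)) ▸ ⇒-elim 𝟙≤x⇒y

  ≤¬-sym : ∀ {x y} → x ≤ ¬ y → y ≤ ¬ x
  ≤¬-sym {x} {y} x≤¬y = ⇒-intro (≡⇒≤ (·-comm y x) ▸ ⇒-elim x≤¬y)

  ≤¬-rotate : ∀ {x y z} → x · y ≤ ¬ z → x · z ≤ ¬ y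
  ≤¬-rotate {x} {y} {z} xy≤¬z = ⇒-intro (≡⇒≤ (·-swapʳ x z y) ▸ ⇒-elim xy≤¬z)

  ≤¬-cut : ∀ {x y z} → x ≤ ¬ z → y ≤ ¬ (¬ z) → x ≤ ¬ y
  ≤¬-cut x≤¬z y≤¬¬z = x≤¬z ▸ ≤¬-sym y≤¬¬z

  ¬¬-intro : ∀ {x} → x ≤ ¬ (¬ x)
  ¬¬-intro = ≤¬-sym ≤-refl

  ¬-anti : ∀ {x y} → x ≤ y → ¬ y ≤ ¬ x
  ¬-anti x≤y = ≤¬-sym (x≤y ▸ ¬¬-intro)

  ¬¬¬≡¬ : ∀ {x} → ¬ (¬ (¬ x)) ≡ ¬ x
  ¬¬¬≡¬ = ≤-antisym (¬-anti ¬¬-intro) ¬¬-intro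

  ⇒¬-swap : ∀ {x y} → x ⇒ ¬ y ≤ y ⇒ ¬ x
  ⇒¬-swap = ⇒-intro (≤¬-rotate ⇒-apply)

  ⇒-contrapose : ∀ {x y} → x ⇒ y ≤ ¬ y ⇒ ¬ x
  ⇒-contrapose = ⇒-intro (≤¬-rotate (⇒-apply ▸ ¬¬-intro))

  ⇒-¬¬ : ∀ {x y} → x ⇒ y ≤ ¬ (¬ x) ⇒ ¬ (¬ y)
  ⇒-¬¬ = ⇒-contrapose ▸ ⇒-contrapose

  ⇒¬¬-¬¬ : ∀ {x y} → y ⇒ ¬ (¬ x) ≤ ¬ (¬ y) ⇒ ¬ (¬ x)
  ⇒¬¬-¬¬ = ⇒¬-swap ▸ ⇒-contrapose

  ⇛-intro : ∀ {c x y} → c ≤ x ⇒ y → c ≤ y ⇒ ¬ (¬ x) → c ≤ x ⇛ y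
  ⇛-intro = ∧-greatest

  ⇛-to : ∀ {x y} → x ⇛ y ≤ x ⇒ y
  ⇛-to = ∧-lowerˡ

  ⇛-from : ∀ {x y} → x ⇛ y ≤ y ⇒ ¬ (¬ x)
  ⇛-from = ∧-lowerʳ

  𝟙≤⇛-intro : ∀ {x y} → x ≤ y → y ≤ ¬ (¬ x) → 𝟙 ≤ x ⇛ y
  𝟙≤⇛-intro x≤y y≤¬¬x = ⇛-intro (⇒-internalise x≤y) (⇒-internalise y≤¬¬x)

  𝟙≤⇛-≤ : ∀ {x y} → 𝟙 ≤ x ⇛ y → x ≤ y
  𝟙≤⇛-≤ 𝟙≤x⇛y = ⇒-externalise (𝟙≤x⇛y ▸ ⇛-to)

  𝟙≤⇛-≤¬¬ : ∀ {x y} → 𝟙 ≤ x ⇛ y → y ≤ ¬ (¬ x)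
  𝟙≤⇛-≤¬¬ 𝟙≤x⇛y = ⇒-externalise (𝟙≤x⇛y ▸ ⇛-from)

  ⇛-refl : ∀ {x} → 𝟙 ≤ x ⇛ x
  ⇛-refl = 𝟙≤⇛-intro ≤-refl ¬¬-intro

  ⇛-trans : ∀ {x y z} → (x ⇛ y) · (y ⇛ z) ≤ x ⇛ z
  ⇛-trans {x} {y} {z} = ⇛-intro
    (·-mono ⇛-to ⇛-to ▸ ⇒-compose)
    (≡⇒≤ (·-comm (x ⇛ y) (y ⇛ z)) ▸ ·-mono ⇛-from (⇛-from ▸ ⇒¬¬-¬¬) ▸ ⇒-compose)

  ⇛-flip-trans : ∀ {x y z} → (x ⇛ y) · (x ⇛ z) ≤ y ⇛ ¬ (¬ z)
  ⇛-flip-trans {x} {y} {z} = ⇛-intro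
    (·-mono ⇛-from (⇛-to ▸ ⇒-¬¬) ▸ ⇒-compose)
    (≡⇒≤ (·-comm (x ⇛ y) (x ⇛ z)) ▸ ·-mono ⇛-from (⇛-to ▸ ⇒-¬¬) ▸ ⇒-compose ▸ ⇒¬¬-¬¬)

  ⇛-contrapose : ∀ {x y} → x ⇛ y ≤ ¬ x ⇛ ¬ y
  ⇛-contrapose = ⇛-intro (⇛-from ▸ ⇒¬-swap) (⇛-to ▸ ⇒-contrapose ▸ ⇒-monoʳ ¬¬-intro)

  BinaryLaw : Set a
  BinaryLaw = ∀ x y → 𝟙 ≤ ((x ⇛ y) ⇛ (¬ (x ⇛ (¬ y))))

  TernaryLaw : Set a
  TernaryLaw = ∀ x y z → 𝟙 ≤ ((x ⇛ y) ⇛ ((y ⇛ z) ⇛ (¬ (x ⇛ (¬ z)))))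

  module _ (binary : BinaryLaw) where

    ⇛-orthogonal : ∀ x y → x ⇛ y ≤ ¬ (x ⇛ ¬ y)
    ⇛-orthogonal x y = 𝟙≤⇛-≤ (binary x y)

    ¬[⇛¬]-≤¬¬⇛ : ∀ x y → ¬ (x ⇛ ¬ y) ≤ ¬ (¬ (x ⇛ y))
    ¬[⇛¬]-≤¬¬⇛ x y = 𝟙≤⇛-≤¬¬ (binary x y)

    ⇛¬¬-≤¬¬⇛ : ∀ x y → x ⇛ ¬ (¬ y) ≤ ¬ (¬ (x ⇛ y))
    ⇛¬¬-≤¬¬⇛ x y = ≤¬-sym (⇛-orthogonal x (¬ y)) ▸ ¬[⇛¬]-≤¬¬⇛ x y

    ¬⇛¬-≤¬¬⇛ : ∀ x y → ¬ x ⇛ ¬ y ≤ ¬ (¬ (x ⇛ y))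
    ¬⇛¬-≤¬¬⇛ x y = ⇛-orthogonal (¬ x) (¬ y) ▸ ¬-anti ⇛-contrapose ▸ ¬[⇛¬]-≤¬¬⇛ x y

    binary⇒ternary : TernaryLaw
    binary⇒ternary x y z = 𝟙≤⇛-intro (⇛-intro P≤Q⇒¬R P≤¬R⇒¬¬Q) M≤¬¬P
      where
      P Q R V M : Carrier
      P = x ⇛ y
      Q = y ⇛ z
      R = x ⇛ ¬ z
      V = x ⇛ ¬ y
      M = Q ⇛ ¬ R

      P≤Q⇒¬R : P ≤ Q ⇒ ¬ R
      P≤Q⇒¬R = ⇒-intro (⇛-trans ▸ ⇛-orthogonal x z)

      P¬Q≤¬[x⇛z] : P · ¬ Q ≤ ¬ (x ⇛ z)
      P¬Q≤¬[x⇛z] = ≤¬-rotate (⇛-flip-trans ▸ ⇛¬¬-≤¬¬⇛ y z)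

      P≤¬R⇒¬¬Q : P ≤ ¬ R ⇒ ¬ (¬ Q)
      P≤¬R⇒¬¬Q = ⇒-intro (≤¬-rotate (≤¬-cut P¬Q≤¬[x⇛z] (¬[⇛¬]-≤¬¬⇛ x z)))

      V≤Q⇛R : V ≤ Q ⇛ R
      V≤Q⇛R = ⇛-intro
        (⇒-intro (·-monoʳ ⇛-contrapose ▸ ⇛-trans))
        (⇒-intro (⇛-flip-trans ▸ ≡⇒≤ (cong (¬ y ⇛_) ¬¬¬≡¬) ▸ ¬⇛¬-≤¬¬⇛ y z))

      M≤¬V : M ≤ ¬ V
      M≤¬V = ≤¬-sym (V≤Q⇛R ▸ ⇛-orthogonal Q R)

      M≤¬¬P : M ≤ ¬ (¬ P)
      M≤¬¬P = M≤¬V ▸ ¬[⇛¬]-≤¬¬⇛ x y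

  ternary⇒binary : TernaryLaw → BinaryLaw
  ternary⇒binary ternary x y = 𝟙≤⇛-intro
    (𝟙≤-discharge ⇛-refl (𝟙≤⇛-≤ (ternary x y y) ▸ ⇛-to))
    (⇒-externalise (⇛-refl ▸ 𝟙≤⇛-≤ (ternary x x y) ▸ ⇛-from))

proposition4p2 : ∀ {a : Level} (A : FLe a) → let open FLe A in
    (∀ x y → 𝟙 ≤ ((x ⇛ y) ⇛ (¬ (x ⇛ (¬ y)))))
    ⇔ (∀ x y z → 𝟙 ≤ ((x ⇛ y) ⇛ ((y ⇛ z) ⇛ (¬ (x ⇛ (¬ z))))))
proposition4p2 A = mk⇔ binary⇒ternary ternary⇒binary
  where open FLeProperties A
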